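{- Let $H$ be any graph. Then (i) $\pi^*(K_n\circ H)=4$ for every $n\ge 3$, and (ii) $\pi^*(K_n\star H)=3$ for every $n\ge 2$.
   Context: For a simple graph $G=(V,E)$, a configuration is a function $\phi:V\to\mathbb{N}\cup\{0\}$; its size is $\sum_{u\in V}\phi(u)$. A pebbling step from a vertex $u$ to a neighbour $v$ removes two pebbles from $u$ and adds one pebble to $v$. For a target $r$, $\phi$ is $r$-solvable if some sequence of pebbling steps places at least one pebble on $r$. The optimal pebbling number $\pi^*(G)$ is the smallest $m$ such that there exists a configuration of size $m$ that is $r$-solvable for every vertex $r$ of $G$. The corona $G\circ H$ is obtained from one copy of $G$ and $|V(G)|$ copies of $H$ by joining the $i$-th vertex of $G$ to every vertex of the $i$-th copy of $H$. The neighbourhood corona $G\star H$ is obtained from one copy of $G$ and $|V(G)|$ copies of $H$ by joining every neighbour (in $G$) of the $i$-th vertex of $G$ to every vertex of the $i$-th copy of $H$. -}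

module Defs where

open import Data.Nat using (ℕ; zero; suc; _+_; _*_; _∸_; _≤_)
open import Data.Fin using (Fin; splitAt; remQuot; _≟_)
open import Data.Vec using (sum; tabulate)
open import Data.Bool using (if_then_else_)
open import Data.Sum using (_⊎_; inj₁; inj₂)
open import Data.Product using (_×_; _,_; ∃; Σ)
open import Relation.Nullary using (¬_; does)
open import Relation.Binary.PropositionalEquality using (_≡_; _≢_)
open import Relation.Binary.Construct.Closure.ReflexiveTransitive using (Star)

record Graph : Set₁ where
  field
    order : ℕ
    Adj   : Fin order → Fin order → Set
open Graph public

record IsSimple (G : Graph) : Set where
  field
    sym     : ∀ {u v} → Adj G u v → Adj G v u
    irrefl  : ∀ {u} → ¬ Adj G u u

K : ℕ → Graph
K n = record { order = n ; Adj = λ i j → i ≢ j }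

-- Vertices of G ∘ H and G ⋆ H: Fin (|G| + |G|·|H|).  The first |G| vertices
-- are the copy of G; vertex (i , a) ∈ Fin |G| × Fin |H| (via remQuot) is
-- vertex a of the i-th copy of H.
AdjSplit : (G H : Graph) →
           (Fin (order G) → Fin (order G) → Set) →   -- how G-vertex i relates to copy j
           Fin (order G) ⊎ (Fin (order G) × Fin (order H)) →
           Fin (order G) ⊎ (Fin (order G) × Fin (order H)) → Set
AdjSplit G H R (inj₁ i) (inj₁ j) = Adj G i j
AdjSplit G H R (inj₁ i) (inj₂ (j , b)) = R i j
AdjSplit G H R (inj₂ (i , a)) (inj₁ j) = R j i
AdjSplit G H R (inj₂ (i , a)) (inj₂ (j , b)) = (i ≡ j) × Adj H a b

decode : (G H : Graph) → Fin (order G + order G * order H) →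
         Fin (order G) ⊎ (Fin (order G) × Fin (order H))
decode G H x with splitAt (order G) x
... | inj₁ i = inj₁ i
... | inj₂ p = inj₂ (remQuot (order H) p)

-- Corona G ∘ H: vertex i of G joined to every vertex of the i-th copy of H.
corona : Graph → Graph → Graph
corona G H = record
  { order = order G + order G * order H
  ; Adj   = λ x y → AdjSplit G H (λ i j → i ≡ j) (decode G H x) (decode G H y) }

-- Neighbourhood corona G ⋆ H: every G-neighbour of vertex j of G joined to
-- every vertex of the j-th copy of H.
nbCorona : Graph → Graph → Graph
nbCorona G H = record
  { order = order G + order G * order H
  ; Adj   = λ x y → AdjSplit G H (λ i j → Adj G i j) (decode G H x) (decode G H y) }

Config : Graph → Set
Config G = Fin (order G) → ℕ

size : (G : Graph) → Config G → ℕ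
size G φ = sum (tabulate φ)

stepConfig : (G : Graph) → Config G → Fin (order G) → Fin (order G) → Config G
stepConfig G φ u v w =
  (if does (w ≟ u) then φ w ∸ 2 else φ w) + (if does (w ≟ v) then 1 else 0)

data Step (G : Graph) (φ : Config G) : Config G → Set where
  step : ∀ u v → Adj G u v → 2 ≤ φ u → Step G φ (stepConfig G φ u v)

Solvable : (G : Graph) → Config G → Fin (order G) → Set
Solvable G φ r = ∃ λ ψ → Star (Step G) φ ψ × 1 ≤ ψ r

OptimalPebblingNumber : Graph → ℕ → Set
OptimalPebblingNumber G m =
  (∃ λ (φ : Config G) → size G φ ≡ m × (∀ r → Solvable G φ r))
  × (∀ (φ : Config G) → (∀ r → Solvable G φ r) → m ≤ size G φ)

-- An unweighted count of pebbles cannot see distances, so the lower bounds use weight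
-- functions: if c y ≤ 2 · c x along every edge x → y, then Σ c · φ never increases under a
-- pebbling step, hence a configuration solving r has Σ c · φ ≥ c r. We take c = 2 ^ h for
-- heights h that rise by at most one along edges. A configuration in which no vertex holds
-- two pebbles can make no move, so it needs a pebble on each of the ≥ 2n vertices. Otherwise
-- some vertex u carries a pile of two. In Kₙ ⋆ H, u is at distance two from a vertex r, and
-- a height that is 0 at u, 2 at r and at most 2 everywhere shows that a third pebble is
-- needed. In Kₙ ∘ H, the weight towards a vertex of the j-th copy of H is at most 8 on the
-- block of j (base vertex j with its copy) and at most 2 elsewhere, so a configuration of at
-- most three pebbles puts a pebble on every block; two blocks other than that of u, together
-- with the pile on u, already hold four.
--
-- Conversely, four pebbles on one base vertex of Kₙ ∘ H reach every vertex at distance at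
-- most two, and in Kₙ ⋆ H two pebbles on base vertex 0 and one on base vertex 1 suffice.

module Submission where

open import Defs
open import Data.Bool using (if_then_else_)
open import Data.Fin using (Fin; zero; suc; _≟_; fromℕ<; splitAt; combine; _↑ˡ_; _↑ʳ_)
open import Data.Fin.Properties
  using (any?; splitAt-↑ˡ; splitAt-↑ʳ; splitAt⁻¹-↑ˡ; splitAt⁻¹-↑ʳ; remQuot-combine; combine-remQuot)
open import Data.Nat using (ℕ; zero; suc; _+_; _*_; _∸_; _^_; _≤_; z≤n; s≤s; _≤?_)
open import Data.Nat.Properties hiding (_≟_)
open import Data.Product using (_×_; _,_; ∃)
open import Data.Sum using (_⊎_; inj₁; inj₂)
open import Data.Sum.Properties using (inj₁-injective)
open import Data.Vec using (tabulate)
import Data.Vec as Vec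
open import Function using (_∘_)
open import Relation.Binary.Construct.Closure.ReflexiveTransitive using (Star; ε; _◅_)
open import Relation.Binary.PropositionalEquality
open import Relation.Nullary using (does; yes; no; contradiction)
open import Relation.Nullary.Decidable using (dec-true; dec-false)

open import Algebra.Properties.Semiring.Sum +-*-semiring
  using (sum-cong-≗; sum-replicate-zero; ∑-distrib-+; *-distribˡ-sum) renaming (sum to ∑)
open import Algebra.Properties.CommutativeSemigroup +-commutativeSemigroup using (xy∙z≈xz∙y)

private variable
  m : ℕ

sum-tabulate : (f : Fin m → ℕ) → Vec.sum (tabulate f) ≡ ∑ f
sum-tabulate {zero}  f = refl
sum-tabulate {suc m} f = cong (f zero +_) (sum-tabulate (f ∘ suc))

∑-mono-≤ : {f g : Fin m → ℕ} → (∀ i → f i ≤ g i) → ∑ f ≤ ∑ g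
∑-mono-≤ {zero}  f≤g = z≤n
∑-mono-≤ {suc m} f≤g = +-mono-≤ (f≤g zero) (∑-mono-≤ (f≤g ∘ suc))

term-≤-∑ : (f : Fin m → ℕ) (i : Fin m) → f i ≤ ∑ f
term-≤-∑ f zero    = m≤m+n _ _
term-≤-∑ f (suc i) = ≤-trans (term-≤-∑ (f ∘ suc) i) (m≤n+m _ _)

∑-const : ∀ k → ∑ {m} (λ _ → k) ≡ m * k
∑-const {zero}  k = refl
∑-const {suc m} k = cong (k +_) (∑-const {m} k)

δ : Fin m → ℕ → Fin m → ℕ
δ u k w = if does (w ≟ u) then k else 0

δ-self : (u : Fin m) (k : ℕ) → δ u k u ≡ k
δ-self u k rewrite dec-true (u ≟ u) refl = refl

δ-other : {u w : Fin m} (k : ℕ) → w ≢ u → δ u k w ≡ 0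
δ-other {u = u} {w} k w≢u rewrite dec-false (w ≟ u) w≢u = refl

δ-≤ : (u : Fin m) (k : ℕ) (w : Fin m) → δ u k w ≤ k
δ-≤ u k w with w ≟ u
... | yes _ = ≤-refl
... | no  _ = z≤n

∑-δ : (u : Fin m) (k : ℕ) → ∑ (δ u k) ≡ k
∑-δ {suc m} zero    k = trans (cong (k +_) (sum-replicate-zero m)) (+-identityʳ k)
∑-δ {suc m} (suc u) k = ∑-δ u k

δ-disjoint : ∀ {k} {j₁ j₂ : Fin k} → j₁ ≢ j₂ → ∀ x → δ j₁ 1 x + δ j₂ 1 x ≤ 1
δ-disjoint {j₁ = j₁} {j₂} j₁≢j₂ x with x ≟ j₁
... | yes refl rewrite δ-other 1 j₁≢j₂ = ≤-refl
... | no  _    = δ-≤ j₂ 1 x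

weight : (c φ : Fin m → ℕ) → ℕ
weight c φ = ∑ λ w → c w * φ w

weight-comm : (c φ : Fin m → ℕ) → weight c φ ≡ weight φ c
weight-comm c φ = sum-cong-≗ λ w → *-comm (c w) (φ w)

weight-congʳ : (c : Fin m → ℕ) {φ ψ : Fin m → ℕ} → (∀ w → φ w ≡ ψ w) → weight c φ ≡ weight c ψ
weight-congʳ c φ≗ψ = sum-cong-≗ λ w → cong (c w *_) (φ≗ψ w)

weight-monoˡ-≤ : {c d : Fin m → ℕ} (φ : Fin m → ℕ) → (∀ w → c w ≤ d w) → weight c φ ≤ weight d φ
weight-monoˡ-≤ φ c≤d = ∑-mono-≤ λ w → *-monoˡ-≤ (φ w) (c≤d w)

weight-+ˡ : (c d φ : Fin m → ℕ) → weight (λ w → c w + d w) φ ≡ weight c φ + weight d φ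
weight-+ˡ c d φ = trans (sum-cong-≗ λ w → *-distribʳ-+ (φ w) (c w) (d w))
                        (∑-distrib-+ (λ w → c w * φ w) (λ w → d w * φ w))

weight-+ʳ : (c φ ψ : Fin m → ℕ) → weight c (λ w → φ w + ψ w) ≡ weight c φ + weight c ψ
weight-+ʳ c φ ψ = trans (sum-cong-≗ λ w → *-distribˡ-+ (c w) (φ w) (ψ w))
                        (∑-distrib-+ (λ w → c w * φ w) (λ w → c w * ψ w))

weight-*ˡ : ∀ k (c φ : Fin m → ℕ) → weight (λ w → k * c w) φ ≡ k * weight c φ
weight-*ˡ k c φ = trans (sum-cong-≗ λ w → *-assoc k (c w) (φ w))
                        (sym (*-distribˡ-sum k (λ w → c w * φ w)))

weight-constˡ : ∀ k (φ : Fin m → ℕ) → weight (λ _ → k) φ ≡ k * ∑ φ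
weight-constˡ k φ = sym (*-distribˡ-sum k φ)

weight-δˡ : (u : Fin m) (k : ℕ) (φ : Fin m → ℕ) → weight (δ u k) φ ≡ k * φ u
weight-δˡ u k φ = trans (sum-cong-≗ δ-*) (∑-δ u (k * φ u))
  where
  δ-* : ∀ w → δ u k w * φ w ≡ δ u (k * φ u) w
  δ-* w with w ≟ u
  ... | yes refl = refl
  ... | no  _    = refl

weight-δʳ : (c : Fin m → ℕ) (u : Fin m) (k : ℕ) → weight c (δ u k) ≡ k * c u
weight-δʳ c u k = trans (weight-comm c (δ u k)) (weight-δˡ u k c)

weight-δ-≤ : ∀ {M d} (c φ : Fin m → ℕ) (u : Fin m) → (∀ w → c w + δ u d w ≤ M) →
             weight c φ + d * φ u ≤ M * ∑ φ
weight-δ-≤ {M = M} {d} c φ u bound = begin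
  weight c φ + d * φ u            ≡⟨ cong (weight c φ +_) (weight-δˡ u d φ) ⟨
  weight c φ + weight (δ u d) φ   ≡⟨ weight-+ˡ c (δ u d) φ ⟨
  weight (λ w → c w + δ u d w) φ  ≤⟨ weight-monoˡ-≤ φ bound ⟩
  weight (λ _ → M) φ              ≡⟨ weight-constˡ M φ ⟩
  M * ∑ φ                         ∎
  where open ≤-Reasoning

size≡∑ : (G : Graph) (φ : Config G) → size G φ ≡ ∑ φ
size≡∑ G φ = sum-tabulate φ

stepConfig-conserves : (G : Graph) (φ : Config G) {u : Fin (order G)} (v : Fin (order G)) →
  2 ≤ φ u → ∀ w → stepConfig G φ u v w + δ u 2 w ≡ φ w + δ v 1 w
stepConfig-conserves G φ {u} v 2≤φu w =
  trans (xy∙z≈xz∙y (debit w) (δ v 1 w) (δ u 2 w)) (cong (_+ δ v 1 w) debit-restored)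
  where
  debit : Fin (order G) → ℕ
  debit w = if does (w ≟ u) then φ w ∸ 2 else φ w
  debit-restored : debit w + δ u 2 w ≡ φ w
  debit-restored with w ≟ u
  ... | yes refl = m∸n+n≡m 2≤φu
  ... | no  _    = +-identityʳ (φ w)

stepConfig-source : (G : Graph) (φ : Config G) (u v : Fin (order G)) →
                    φ u ∸ 2 ≤ stepConfig G φ u v u
stepConfig-source G φ u v rewrite dec-true (u ≟ u) refl = m≤m+n _ _

stepConfig-target : (G : Graph) (φ : Config G) (u v : Fin (order G)) → 1 ≤ stepConfig G φ u v v
stepConfig-target G φ u v rewrite dec-true (v ≟ v) refl = m≤n+m 1 _

stepConfig-target-≢ : (G : Graph) (φ : Config G) {u v : Fin (order G)} → v ≢ u →
                      stepConfig G φ u v v ≡ suc (φ v)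
stepConfig-target-≢ G φ {u} {v} v≢u
  rewrite dec-true (v ≟ v) refl | dec-false (v ≟ u) v≢u = +-comm (φ v) 1

solvable-◅ : {G : Graph} {φ ψ : Config G} {r : Fin (order G)} →
             Step G φ ψ → Solvable G ψ r → Solvable G φ r
solvable-◅ s (χ , ψ⋆χ , 1≤χr) = χ , s ◅ ψ⋆χ , 1≤χr

module _ (G : Graph) where

  solvable-adjacent : ∀ {φ u v} → Adj G u v → 2 ≤ φ u → Solvable G φ v
  solvable-adjacent {φ} {u} {v} u~v 2≤φu = _ , step u v u~v 2≤φu ◅ ε , stepConfig-target G φ u v

  solvable-relay : ∀ {φ u v r} → Adj G u v → Adj G v r → v ≢ u → 2 ≤ φ u → 1 ≤ φ v → Solvable G φ r
  solvable-relay {φ} {u} {v} u~v v~r v≢u 2≤φu 1≤φv =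
    solvable-◅ (step u v u~v 2≤φu)
      (solvable-adjacent v~r (subst (2 ≤_) (sym (stepConfig-target-≢ G φ v≢u)) (s≤s 1≤φv)))

  solvable-distance-two : ∀ {φ u v r} → Adj G u v → Adj G v r → v ≢ u → 4 ≤ φ u → Solvable G φ r
  solvable-distance-two {φ} {u} {v} u~v v~r v≢u 4≤φu =
    solvable-◅ (step u v u~v (≤-trans (s≤s (s≤s z≤n)) 4≤φu))
      (solvable-relay u~v v~r v≢u (≤-trans (∸-monoˡ-≤ 2 4≤φu) (stepConfig-source G φ u v))
                                  (stepConfig-target G φ u v))

IsWeightFunction : (G : Graph) → (Fin (order G) → ℕ) → Set
IsWeightFunction G c = ∀ {x y} → Adj G x y → c y ≤ 2 * c x

module _ {G : Graph} {c : Fin (order G) → ℕ} (isWeight : IsWeightFunction G c) where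

  weight-step : ∀ {φ ψ} → Step G φ ψ → weight c ψ ≤ weight c φ
  weight-step {φ} (step u v u~v 2≤φu) = +-cancelʳ-≤ (2 * c u) _ _ (begin
    weight c ψ + 2 * c u                ≡⟨ cong (weight c ψ +_) (weight-δʳ c u 2) ⟨
    weight c ψ + weight c (δ u 2)       ≡⟨ weight-+ʳ c ψ (δ u 2) ⟨
    weight c (λ w → ψ w + δ u 2 w)      ≡⟨ weight-congʳ c (stepConfig-conserves G φ v 2≤φu) ⟩
    weight c (λ w → φ w + δ v 1 w)      ≡⟨ weight-+ʳ c φ (δ v 1) ⟩
    weight c φ + weight c (δ v 1)       ≡⟨ cong (weight c φ +_) (weight-δʳ c v 1) ⟩
    weight c φ + 1 * c v                ≡⟨ cong (weight c φ +_) (*-identityˡ (c v)) ⟩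
    weight c φ + c v                    ≤⟨ +-monoʳ-≤ (weight c φ) (isWeight u~v) ⟩
    weight c φ + 2 * c u                ∎)
    where
    open ≤-Reasoning
    ψ = stepConfig G φ u v

  weight-steps : ∀ {φ ψ} → Star (Step G) φ ψ → weight c ψ ≤ weight c φ
  weight-steps ε          = ≤-refl
  weight-steps (s ◅ s⋆) = ≤-trans (weight-steps s⋆) (weight-step s)

  weight-solvable : ∀ {φ r} → Solvable G φ r → c r ≤ weight c φ
  weight-solvable {φ} {r} (ψ , φ⋆ψ , 1≤ψr) = begin
    c r          ≡⟨ *-identityʳ (c r) ⟨
    c r * 1      ≤⟨ *-monoʳ-≤ (c r) 1≤ψr ⟩
    c r * ψ r    ≤⟨ term-≤-∑ (λ w → c w * ψ w) r ⟩
    weight c ψ   ≤⟨ weight-steps φ⋆ψ ⟩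
    weight c φ   ∎
    where open ≤-Reasoning

RisesByAtMostOne : (G : Graph) → (Fin (order G) → ℕ) → Set
RisesByAtMostOne G h = ∀ {x y} → Adj G x y → h y ≤ suc (h x)

exp-isWeightFunction : {G : Graph} {h : Fin (order G) → ℕ} → RisesByAtMostOne G h →
                       IsWeightFunction G (λ v → 2 ^ h v)
exp-isWeightFunction rises x~y = ^-monoʳ-≤ 2 (rises x~y)

immovable-solvable⇒occupied : (G : Graph) (φ : Config G) {r : Fin (order G)} →
                              (∀ v → φ v ≤ 1) → Solvable G φ r → 1 ≤ φ r
immovable-solvable⇒occupied G φ φ≤1 (_ , ε , 1≤φr)                  = 1≤φr
immovable-solvable⇒occupied G φ φ≤1 (_ , step u _ _ 2≤φu ◅ _ , _) = contradiction 2≤φu (<⇒≱ (s≤s (φ≤1 u)))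

immovable-order≤size : (G : Graph) (φ : Config G) → (∀ v → φ v ≤ 1) →
                       (∀ r → Solvable G φ r) → order G ≤ size G φ
immovable-order≤size G φ φ≤1 solves = begin
  order G               ≡⟨ *-identityʳ (order G) ⟨
  order G * 1           ≡⟨ ∑-const {order G} 1 ⟨
  ∑ {order G} (λ _ → 1) ≤⟨ ∑-mono-≤ (λ r → immovable-solvable⇒occupied G φ φ≤1 (solves r)) ⟩
  ∑ φ                   ≡⟨ size≡∑ G φ ⟨
  size G φ              ∎
  where open ≤-Reasoning

pile-or-spread : (φ : Fin m → ℕ) → (∃ λ u → 2 ≤ φ u) ⊎ (∀ v → φ v ≤ 1)
pile-or-spread φ with any? (λ u → 2 ≤? φ u)
... | yes pile  = inj₁ pile
... | no ¬pile = inj₂ λ v → ≮⇒≥ λ 1<φv → ¬pile (v , 1<φv)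

pile-needs-three : (G : Graph) (h : Fin (order G) → ℕ) → RisesByAtMostOne G h → (∀ x → h x ≤ 2) →
                   ∀ {φ u r} → h u ≡ 0 → h r ≡ 2 → Solvable G φ r → 2 ≤ φ u → 3 ≤ ∑ φ
pile-needs-three G h rises h≤2 {φ} {u} {r} hu≡0 hr≡2 solvable 2≤φu =
  *-cancelˡ-< 4 2 (∑ φ) (begin-strict
    4 * 2                  <⟨ n≤1+n 9 ⟩
    4 + 3 * 2              ≤⟨ +-mono-≤ 4≤weight (*-monoʳ-≤ 3 2≤φu) ⟩
    weight c φ + 3 * φ u   ≤⟨ weight-δ-≤ c φ u c+δ≤4 ⟩
    4 * ∑ φ                ∎)
  where
  open ≤-Reasoning
  c : Fin (order G) → ℕ
  c x = 2 ^ h x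
  4≤weight : 4 ≤ weight c φ
  4≤weight = subst (λ k → 2 ^ k ≤ weight c φ) hr≡2
               (weight-solvable {c = c} (exp-isWeightFunction {h = h} rises) solvable)
  c+δ≤4 : ∀ w → c w + δ u 3 w ≤ 4
  c+δ≤4 w with w ≟ u
  ... | yes refl rewrite hu≡0 = ≤-refl
  ... | no  _    = ≤-trans (≤-reflexive (+-identityʳ (c w))) (^-monoʳ-≤ 2 (h≤2 w))

pile-and-two-blocks : ∀ {p s} b₁ b₂ → 2 ≤ p → b₁ + b₂ + p ≤ s →
                      8 ≤ 2 * s + 6 * b₁ → 8 ≤ 2 * s + 6 * b₂ → 4 ≤ s
pile-and-two-blocks zero     _        _   _    8≤ _  = *-cancelˡ-≤ 2 (subst (8 ≤_) (+-identityʳ _) 8≤)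
pile-and-two-blocks (suc _)  zero     _   _    _  8≤ = *-cancelˡ-≤ 2 (subst (8 ≤_) (+-identityʳ _) 8≤)
pile-and-two-blocks (suc b₁) (suc b₂) 2≤p b+p≤s _  _  =
  ≤-trans (+-mono-≤ (s≤s (≤-trans (s≤s z≤n) (m≤n+m (suc b₂) b₁))) 2≤p) b+p≤s

two-others : ∀ {n} → 3 ≤ n → (i : Fin n) → ∃ λ j₁ → ∃ λ j₂ → i ≢ j₁ × i ≢ j₂ × j₁ ≢ j₂
two-others (s≤s (s≤s (s≤s _))) zero          = suc zero , suc (suc zero) , (λ ()) , (λ ()) , (λ ())
two-others (s≤s (s≤s (s≤s _))) (suc zero)    = zero , suc (suc zero) , (λ ()) , (λ ()) , (λ ())
two-others (s≤s (s≤s (s≤s _))) (suc (suc _)) = zero , suc zero , (λ ()) , (λ ()) , (λ ())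

CoronaVertex : Graph → Graph → Set
CoronaVertex G H = Fin (order G) ⊎ (Fin (order G) × Fin (order H))

block : {A B : Set} → A ⊎ (A × B) → A
block (inj₁ i)       = i
block (inj₂ (i , _)) = i

module _ (G H : Graph) where

  encode : CoronaVertex G H → Fin (order G + order G * order H)
  encode (inj₁ i)       = i ↑ˡ (order G * order H)
  encode (inj₂ (i , a)) = order G ↑ʳ combine i a

  decode-encode : ∀ p → decode G H (encode p) ≡ p
  decode-encode (inj₁ i)
    rewrite splitAt-↑ˡ (order G) i (order G * order H) = refl
  decode-encode (inj₂ (i , a))
    rewrite splitAt-↑ʳ (order G) (order G * order H) (combine i a)
          | remQuot-combine {order G} {order H} i a = refl

  encode-decode : ∀ x → encode (decode G H x) ≡ x
  encode-decode x with splitAt (order G) x in eq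
  ... | inj₁ i = splitAt⁻¹-↑ˡ eq
  ... | inj₂ p = trans (cong (order G ↑ʳ_) (combine-remQuot {order G} (order H) p)) (splitAt⁻¹-↑ʳ eq)

  encode-injective : ∀ {p q} → encode p ≡ encode q → p ≡ q
  encode-injective {p} {q} eq =
    trans (sym (decode-encode p)) (trans (cong (decode G H) eq) (decode-encode q))

  base-≢ : ∀ {i j} → i ≢ j → encode (inj₁ i) ≢ encode (inj₁ j)
  base-≢ i≢j = i≢j ∘ inj₁-injective ∘ encode-injective

  all-encoded : {P : Fin (order G + order G * order H) → Set} → (∀ p → P (encode p)) → ∀ x → P x
  all-encoded {P} P-encode x = subst P (encode-decode x) (P-encode (decode G H x))

  corona-adj : ∀ p q → AdjSplit G H (λ i j → i ≡ j) p q → Adj (corona G H) (encode p) (encode q)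
  corona-adj p q = subst₂ (AdjSplit G H (λ i j → i ≡ j)) (sym (decode-encode p)) (sym (decode-encode q))

  nbCorona-adj : ∀ p q → AdjSplit G H (Adj G) p q → Adj (nbCorona G H) (encode p) (encode q)
  nbCorona-adj p q = subst₂ (AdjSplit G H (Adj G)) (sym (decode-encode p)) (sym (decode-encode q))

  order-corona-≥ : 1 ≤ order H → order G + order G ≤ order G + order G * order H
  order-corona-≥ 1≤|H| = +-monoʳ-≤ (order G) (≤-trans (≤-reflexive (sym (*-identityʳ (order G))))
                                                       (*-monoʳ-≤ (order G) 1≤|H|))

module _ (H : Graph) {m : ℕ} where

  private
    n : ℕ
    n = suc m
    G = corona (K n) H
    g : Fin n → Fin (order G)
    g k = encode (K n) H (inj₁ k)
    φ : Config G
    φ = δ (g zero) 4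
    4≤φg₀ : 4 ≤ φ (g zero)
    4≤φg₀ = ≤-reflexive (sym (δ-self (g zero) 4))
    2≤φg₀ : 2 ≤ φ (g zero)
    2≤φg₀ = ≤-trans (s≤s (s≤s z≤n)) 4≤φg₀
    adj : ∀ p q → AdjSplit (K n) H (λ i j → i ≡ j) p q → Adj G (encode (K n) H p) (encode (K n) H q)
    adj = corona-adj (K n) H

  corona-upper : ∃ λ (φ : Config G) → size G φ ≡ 4 × (∀ r → Solvable G φ r)
  corona-upper = φ , trans (size≡∑ G φ) (∑-δ (g zero) 4) , all-encoded (K n) H solves
    where
    solves : ∀ p → Solvable G φ (encode (K n) H p)
    solves (inj₁ zero)        = φ , ε , ≤-trans (s≤s z≤n) 4≤φg₀
    solves (inj₁ (suc k))     =
      solvable-adjacent G {u = g zero} (adj (inj₁ zero) (inj₁ (suc k)) (λ ())) 2≤φg₀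
    solves (inj₂ (zero , a))  =
      solvable-adjacent G {u = g zero} (adj (inj₁ zero) (inj₂ (zero , a)) refl) 2≤φg₀
    solves (inj₂ (suc k , a)) =
      solvable-distance-two G {u = g zero} {v = g (suc k)}
        (adj (inj₁ zero) (inj₁ (suc k)) (λ ())) (adj (inj₁ (suc k)) (inj₂ (suc k , a)) refl)
        (base-≢ (K n) H λ ()) 4≤φg₀

module _ (H : Graph) {m : ℕ} where

  private
    n : ℕ
    n = suc (suc m)
    G = nbCorona (K n) H
    g : Fin n → Fin (order G)
    g k = encode (K n) H (inj₁ k)
    φ : Config G
    φ w = δ (g zero) 2 w + δ (g (suc zero)) 1 w
    2≤φg₀ : 2 ≤ φ (g zero)
    2≤φg₀ = ≤-trans (≤-reflexive (sym (δ-self (g zero) 2))) (m≤m+n 2 _)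
    1≤φg₁ : 1 ≤ φ (g (suc zero))
    1≤φg₁ = ≤-trans (≤-reflexive (sym (δ-self (g (suc zero)) 1))) (m≤n+m 1 (δ (g zero) 2 (g (suc zero))))
    adj : ∀ p q → AdjSplit (K n) H (Adj (K n)) p q → Adj G (encode (K n) H p) (encode (K n) H q)
    adj = nbCorona-adj (K n) H

  nbCorona-upper : ∃ λ (φ : Config G) → size G φ ≡ 3 × (∀ r → Solvable G φ r)
  nbCorona-upper = φ , size≡3 , all-encoded (K n) H solves
    where
    size≡3 : size G φ ≡ 3
    size≡3 = begin
      size G φ                                    ≡⟨ size≡∑ G φ ⟩
      ∑ φ                                         ≡⟨ ∑-distrib-+ (δ (g zero) 2) (δ (g (suc zero)) 1) ⟩
      ∑ (δ (g zero) 2) + ∑ (δ (g (suc zero)) 1)   ≡⟨ cong₂ _+_ (∑-δ (g zero) 2) (∑-δ (g (suc zero)) 1) ⟩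
      3                                           ∎
      where open ≡-Reasoning
    solves : ∀ p → Solvable G φ (encode (K n) H p)
    solves (inj₁ zero)        = φ , ε , ≤-trans (s≤s z≤n) 2≤φg₀
    solves (inj₁ (suc k))     =
      solvable-adjacent G {u = g zero} (adj (inj₁ zero) (inj₁ (suc k)) (λ ())) 2≤φg₀
    solves (inj₂ (suc k , a)) =
      solvable-adjacent G {u = g zero} (adj (inj₁ zero) (inj₂ (suc k , a)) (λ ())) 2≤φg₀
    solves (inj₂ (zero , a))  =
      solvable-relay G {u = g zero} {v = g (suc zero)}
        (adj (inj₁ zero) (inj₁ (suc zero)) (λ ())) (adj (inj₁ (suc zero)) (inj₂ (zero , a)) (λ ()))
        (base-≢ (K n) H λ ()) 2≤φg₀ 1≤φg₁

-- Each height is max(0, t − d), where t is its value at the target and d is the distance to the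
-- target once H is replaced by a complete graph; hence it rises by at most one along every edge.
module Heights {H : Graph} {n : ℕ} (a0 : Fin (order H)) where

  private
    Vertex = CoronaVertex (K n) H

  coronaHeight : Fin n → Vertex → ℕ
  coronaHeight j (inj₁ k)       = if does (k ≟ j) then 2 else 1
  coronaHeight j (inj₂ (k , b)) = if does (k ≟ j) then 2 + δ a0 1 b else 0

  coronaHeight-rises : ∀ j p q → AdjSplit (K n) H (λ i j → i ≡ j) p q →
                       coronaHeight j q ≤ suc (coronaHeight j p)
  coronaHeight-rises j (inj₁ k) (inj₁ l) _ with k ≟ j | l ≟ j
  ... | yes _ | yes _ = n≤1+n 2
  ... | yes _ | no  _ = s≤s z≤n
  ... | no  _ | yes _ = ≤-refl
  ... | no  _ | no  _ = n≤1+n 1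
  coronaHeight-rises j (inj₁ k) (inj₂ (k , b)) refl with k ≟ j
  ... | yes _ = s≤s (s≤s (δ-≤ a0 1 b))
  ... | no  _ = z≤n
  coronaHeight-rises j (inj₂ (k , a)) (inj₁ k) refl with k ≟ j
  ... | yes _ = s≤s (m≤m+n 1 _)
  ... | no  _ = s≤s z≤n
  coronaHeight-rises j (inj₂ (k , a)) (inj₂ (k , b)) (refl , _) with k ≟ j
  ... | yes _ = s≤s (s≤s (≤-trans (δ-≤ a0 1 b) (s≤s z≤n)))
  ... | no  _ = z≤n

  coronaHeight-target : ∀ j → coronaHeight j (inj₂ (j , a0)) ≡ 3
  coronaHeight-target j rewrite dec-true (j ≟ j) refl | δ-self a0 1 = refl

  coronaWeight-≤ : ∀ j p → 2 ^ coronaHeight j p ≤ 2 + 6 * δ j 1 (block p)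
  coronaWeight-≤ j (inj₁ k) with k ≟ j
  ... | yes _ = m≤m+n 4 4
  ... | no  _ = ≤-refl
  coronaWeight-≤ j (inj₂ (k , b)) with k ≟ j
  ... | yes _ = ^-monoʳ-≤ 2 (+-monoʳ-≤ 2 (δ-≤ a0 1 b))
  ... | no  _ = s≤s z≤n

  nbCoronaCopyHeight : Fin n → Vertex → ℕ
  nbCoronaCopyHeight i (inj₁ k)       = if does (k ≟ i) then 0 else 1
  nbCoronaCopyHeight i (inj₂ (k , b)) = if does (k ≟ i) then 1 + δ a0 1 b else 0

  nbCoronaBaseHeight : Fin n → Vertex → ℕ
  nbCoronaBaseHeight i (inj₁ k)       = if does (k ≟ i) then 2 else 1
  nbCoronaBaseHeight i (inj₂ (k , b)) = if does (k ≟ i) then 0 else 1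

  nbCoronaCopyHeight-rises : ∀ i p q → AdjSplit (K n) H (Adj (K n)) p q →
                             nbCoronaCopyHeight i q ≤ suc (nbCoronaCopyHeight i p)
  nbCoronaCopyHeight-rises i p (inj₁ l) _ with l ≟ i
  ... | yes _ = z≤n
  ... | no  _ = s≤s z≤n
  nbCoronaCopyHeight-rises i (inj₁ k) (inj₂ (l , b)) k≢l with l ≟ i
  ... | yes refl rewrite dec-false (k ≟ l) k≢l = s≤s (δ-≤ a0 1 b)
  ... | no  _    = z≤n
  nbCoronaCopyHeight-rises i (inj₂ (k , a)) (inj₂ (k , b)) (refl , _) with k ≟ i
  ... | yes _ = s≤s (≤-trans (δ-≤ a0 1 b) (m≤m+n 1 _))
  ... | no  _ = z≤n

  nbCoronaBaseHeight-rises : ∀ i p q → AdjSplit (K n) H (Adj (K n)) p q →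
                             nbCoronaBaseHeight i q ≤ suc (nbCoronaBaseHeight i p)
  nbCoronaBaseHeight-rises i (inj₁ k) (inj₁ l) k≢l with l ≟ i
  ... | yes refl rewrite dec-false (k ≟ l) k≢l = ≤-refl
  ... | no  _    = s≤s z≤n
  nbCoronaBaseHeight-rises i (inj₂ (k , a)) (inj₁ l) l≢k with l ≟ i
  ... | yes refl rewrite dec-false (k ≟ l) (l≢k ∘ sym) = ≤-refl
  ... | no  _    = s≤s z≤n
  nbCoronaBaseHeight-rises i p (inj₂ (l , b)) _ with l ≟ i
  ... | yes _ = z≤n
  ... | no  _ = s≤s z≤n

  nbCoronaCopyHeight-≤ : ∀ i p → nbCoronaCopyHeight i p ≤ 2
  nbCoronaCopyHeight-≤ i (inj₁ k) with k ≟ i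
  ... | yes _ = z≤n
  ... | no  _ = s≤s z≤n
  nbCoronaCopyHeight-≤ i (inj₂ (k , b)) with k ≟ i
  ... | yes _ = s≤s (δ-≤ a0 1 b)
  ... | no  _ = z≤n

  nbCoronaCopyHeight-source : ∀ i → nbCoronaCopyHeight i (inj₁ i) ≡ 0
  nbCoronaCopyHeight-source i rewrite dec-true (i ≟ i) refl = refl

  nbCoronaCopyHeight-target : ∀ i → nbCoronaCopyHeight i (inj₂ (i , a0)) ≡ 2
  nbCoronaCopyHeight-target i rewrite dec-true (i ≟ i) refl | δ-self a0 1 = refl

  nbCoronaBaseHeight-≤ : ∀ i p → nbCoronaBaseHeight i p ≤ 2
  nbCoronaBaseHeight-≤ i (inj₁ k) with k ≟ i
  ... | yes _ = ≤-refl
  ... | no  _ = s≤s z≤n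
  nbCoronaBaseHeight-≤ i (inj₂ (k , b)) with k ≟ i
  ... | yes _ = z≤n
  ... | no  _ = s≤s z≤n

  nbCoronaBaseHeight-source : ∀ i a → nbCoronaBaseHeight i (inj₂ (i , a)) ≡ 0
  nbCoronaBaseHeight-source i a rewrite dec-true (i ≟ i) refl = refl

  nbCoronaBaseHeight-target : ∀ i → nbCoronaBaseHeight i (inj₁ i) ≡ 2
  nbCoronaBaseHeight-target i rewrite dec-true (i ≟ i) refl = refl

module _ (H : Graph) (1≤|H| : 1 ≤ order H) {n : ℕ} where

  private
    a0 : Fin (order H)
    a0 = fromℕ< 1≤|H|
    lift : (CoronaVertex (K n) H → ℕ) → Fin (n + n * order H) → ℕ
    lift h x = h (decode (K n) H x)
    lift-encode : (h : CoronaVertex (K n) H → ℕ) (p : CoronaVertex (K n) H) {k : ℕ} →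
                  h p ≡ k → lift h (encode (K n) H p) ≡ k
    lift-encode h p = trans (cong h (decode-encode (K n) H p))
    Corona = corona (K n) H
    NbCorona = nbCorona (K n) H
    inBlock : Fin n → Fin (order Corona) → ℕ
    inBlock j = lift (δ j 1 ∘ block)

  open Heights {H} {n} a0

  corona-block-weight : (j : Fin n) {φ : Config Corona} →
    Solvable Corona φ (encode (K n) H (inj₂ (j , a0))) → 8 ≤ 2 * ∑ φ + 6 * weight (inBlock j) φ
  corona-block-weight j {φ} solvable = begin
    8
      ≡⟨ cong (2 ^_) (lift-encode (coronaHeight j) (inj₂ (j , a0)) (coronaHeight-target j)) ⟨
    c (encode (K n) H (inj₂ (j , a0)))
      ≤⟨ weight-solvable {c = c} (exp-isWeightFunction {h = h} rises) solvable ⟩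
    weight c φ
      ≤⟨ weight-monoˡ-≤ φ (coronaWeight-≤ j ∘ decode (K n) H) ⟩
    weight (λ x → 2 + 6 * inBlock j x) φ
      ≡⟨ weight-+ˡ (λ _ → 2) (λ x → 6 * inBlock j x) φ ⟩
    weight (λ _ → 2) φ + weight (λ x → 6 * inBlock j x) φ
      ≡⟨ cong₂ _+_ (weight-constˡ 2 φ) (weight-*ˡ 6 (inBlock j) φ) ⟩
    2 * ∑ φ + 6 * weight (inBlock j) φ ∎
    where
    open ≤-Reasoning
    h : Fin (order Corona) → ℕ
    h = lift (coronaHeight j)
    c : Fin (order Corona) → ℕ
    c x = 2 ^ h x
    rises : RisesByAtMostOne Corona h
    rises {x} {y} = coronaHeight-rises j (decode (K n) H x) (decode (K n) H y)

  corona-pile : 3 ≤ n → (φ : Config Corona) → (∀ r → Solvable Corona φ r) →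
                ∀ {u} → 2 ≤ φ u → 4 ≤ ∑ φ
  corona-pile 3≤n φ solves {u} 2≤φu with two-others 3≤n (block (decode (K n) H u))
  ... | j₁ , j₂ , u∉j₁ , u∉j₂ , j₁≢j₂ =
    pile-and-two-blocks (weight (inBlock j₁) φ) (weight (inBlock j₂) φ) 2≤φu blocks+pile≤∑
      (corona-block-weight j₁ (solves _)) (corona-block-weight j₂ (solves _))
    where
    open ≤-Reasoning
    disjoint : ∀ w → inBlock j₁ w + inBlock j₂ w + δ u 1 w ≤ 1
    disjoint w with w ≟ u
    ... | yes refl rewrite δ-other 1 u∉j₁ | δ-other 1 u∉j₂ = ≤-refl
    ... | no  _    = subst (_≤ 1) (sym (+-identityʳ _)) (δ-disjoint j₁≢j₂ (block (decode (K n) H w)))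
    blocks+pile≤∑ : weight (inBlock j₁) φ + weight (inBlock j₂) φ + φ u ≤ ∑ φ
    blocks+pile≤∑ = begin
      weight (inBlock j₁) φ + weight (inBlock j₂) φ + φ u
        ≡⟨ cong₂ _+_ (weight-+ˡ (inBlock j₁) (inBlock j₂) φ) (*-identityˡ (φ u)) ⟨
      weight (λ w → inBlock j₁ w + inBlock j₂ w) φ + 1 * φ u
        ≤⟨ weight-δ-≤ (λ w → inBlock j₁ w + inBlock j₂ w) φ u disjoint ⟩
      1 * ∑ φ
        ≡⟨ *-identityˡ (∑ φ) ⟩
      ∑ φ ∎

  corona-lower : 3 ≤ n → (φ : Config Corona) → (∀ r → Solvable Corona φ r) → 4 ≤ size Corona φ
  corona-lower 3≤n φ solves with pile-or-spread φ
  ... | inj₁ (u , 2≤φu) = subst (4 ≤_) (sym (size≡∑ Corona φ)) (corona-pile 3≤n φ solves 2≤φu)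
  ... | inj₂ spread     = begin
    4        ≤⟨ ≤-trans (m≤m+n 4 2) (+-mono-≤ 3≤n 3≤n) ⟩
    n + n    ≤⟨ order-corona-≥ (K n) H 1≤|H| ⟩
    order Corona  ≤⟨ immovable-order≤size Corona φ spread solves ⟩
    size Corona φ ∎
    where open ≤-Reasoning

  nbCorona-pile : (φ : Config NbCorona) → (∀ r → Solvable NbCorona φ r) →
                  ∀ p → 2 ≤ φ (encode (K n) H p) → 3 ≤ ∑ φ
  nbCorona-pile φ solves (inj₁ i) =
    pile-needs-three NbCorona (lift (nbCoronaCopyHeight i))
      (λ {x} {y} → nbCoronaCopyHeight-rises i (decode (K n) H x) (decode (K n) H y))
      (λ x → nbCoronaCopyHeight-≤ i (decode (K n) H x))
      (lift-encode (nbCoronaCopyHeight i) (inj₁ i) (nbCoronaCopyHeight-source i))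
      (lift-encode (nbCoronaCopyHeight i) (inj₂ (i , a0)) (nbCoronaCopyHeight-target i))
      (solves _)
  nbCorona-pile φ solves (inj₂ (i , a)) =
    pile-needs-three NbCorona (lift (nbCoronaBaseHeight i))
      (λ {x} {y} → nbCoronaBaseHeight-rises i (decode (K n) H x) (decode (K n) H y))
      (λ x → nbCoronaBaseHeight-≤ i (decode (K n) H x))
      (lift-encode (nbCoronaBaseHeight i) (inj₂ (i , a)) (nbCoronaBaseHeight-source i a))
      (lift-encode (nbCoronaBaseHeight i) (inj₁ i) (nbCoronaBaseHeight-target i))
      (solves _)

  nbCorona-lower : 2 ≤ n → (φ : Config NbCorona) → (∀ r → Solvable NbCorona φ r) → 3 ≤ size NbCorona φ
  nbCorona-lower 2≤n φ solves with pile-or-spread φ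
  ... | inj₁ (u , 2≤φu) =
    subst (3 ≤_) (sym (size≡∑ NbCorona φ))
      (nbCorona-pile φ solves (decode (K n) H u)
        (subst (λ x → 2 ≤ φ x) (sym (encode-decode (K n) H u)) 2≤φu))
  ... | inj₂ spread     = begin
    3        ≤⟨ ≤-trans (m≤m+n 3 1) (+-mono-≤ 2≤n 2≤n) ⟩
    n + n    ≤⟨ order-corona-≥ (K n) H 1≤|H| ⟩
    order NbCorona  ≤⟨ immovable-order≤size NbCorona φ spread solves ⟩
    size NbCorona φ ∎
    where open ≤-Reasoning

mainTheorem11 : (H : Graph) → IsSimple H → 1 ≤ order H →
    ((n : ℕ) → 3 ≤ n → OptimalPebblingNumber (corona (K n) H) 4)
    × ((n : ℕ) → 2 ≤ n → OptimalPebblingNumber (nbCorona (K n) H) 3)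
mainTheorem11 H _ 1≤|H| = coronaK , nbCoronaK
  where
  coronaK : (n : ℕ) → 3 ≤ n → OptimalPebblingNumber (corona (K n) H) 4
  coronaK (suc m) 3≤n = corona-upper H {m} , corona-lower H 1≤|H| 3≤n
  nbCoronaK : (n : ℕ) → 2 ≤ n → OptimalPebblingNumber (nbCorona (K n) H) 3
  nbCoronaK (suc (suc m)) 2≤n = nbCorona-upper H {m} , nbCorona-lower H 1≤|H| 2≤n
  nbCoronaK (suc zero) (s≤s ())
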